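{- If $\lambda$ is a partition with $\sigma(\lambda)=r$ and $|\lambda|>T_r=r(r+1)/2$, then $\operatorname{deg}(\lambda)\ge r(r-1)+1$, where $\operatorname{deg}(\lambda)$ is the degree of $\lambda$ as a vertex of $G_{|\lambda|}$.
   Context: $G_n$ is the partition graph: its vertices are the partitions of $n$, and two distinct partitions $\lambda\neq\mu$ are adjacent when $\mu$ is obtained from $\lambda$ by moving one cell from one part (of size $x$, the part shrinking to $x-1$ and disappearing if $x=1$) to another part or to a new part of size $1$, followed by reordering the parts in weakly decreasing order. $\sigma(\lambda)$ is the number of distinct part sizes of $\lambda$ and $|\lambda|$ is the sum of its parts. -}

module Defs where

open import Data.Nat using (ℕ; zero; suc; _+_; _*_; _∸_; _≤_; _<_; _≥_; _≤ᵇ_)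
open import Data.Nat.Properties using (_≟_)
open import Data.Bool using (Bool; true; false; if_then_else_)
open import Data.List using (List; []; _∷_; length; filter; deduplicate; concatMap; map; upTo)
open import Data.List.Properties using (≡-dec)
open import Data.List.Relation.Unary.All using (All)
open import Data.List.Relation.Unary.Linked using (Linked)
open import Data.Nat.ListAction using (sum)
open import Data.Maybe using (Maybe; just; nothing)
open import Relation.Nullary using (¬?)

IsPartition : List ℕ → Set
IsPartition xs = Linked _≥_ xs × All (λ x → 0 < x) xs
  where open import Data.Product using (_×_)

size : List ℕ → ℕ
size = sum

σ : List ℕ → ℕ
σ xs = length (deduplicate _≟_ xs)

insertDesc : ℕ → List ℕ → List ℕ
insertDesc x [] = x ∷ []
insertDesc x (y ∷ ys) = if y ≤ᵇ x then x ∷ y ∷ ys else y ∷ insertDesc x ys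

sortDesc : List ℕ → List ℕ
sortDesc [] = []
sortDesc (x ∷ xs) = insertDesc x (sortDesc xs)

normalize : List ℕ → List ℕ
normalize xs = sortDesc (filter (λ x → ¬? (x ≟ 0)) xs)

decAt : ℕ → List ℕ → List ℕ
decAt i [] = []
decAt zero (x ∷ xs) = (x ∸ 1) ∷ xs
decAt (suc i) (x ∷ xs) = x ∷ decAt i xs

incAt : ℕ → List ℕ → List ℕ
incAt i [] = []
incAt zero (x ∷ xs) = suc x ∷ xs
incAt (suc i) (x ∷ xs) = x ∷ incAt i xs

-- move one cell from the part at position i to the part at position j
-- (just j, j ≠ i) or to a new part of size 1 (nothing), then reorder
move : ℕ → Maybe ℕ → List ℕ → List ℕ
move i (just j) xs = normalize (incAt j (decAt i xs))
move i nothing  xs = normalize (1 ∷ decAt i xs)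

moves : List ℕ → List (List ℕ)
moves xs = concatMap (λ i →
    move i nothing xs ∷
    map (λ j → move i (just j) xs)
        (filter (λ j → ¬? (j ≟ i)) (upTo (length xs))))
  (upTo (length xs))

neighbours : List ℕ → List (List ℕ)
neighbours xs = deduplicate (≡-dec _≟_) (filter (λ m → ¬? (≡-dec _≟_ m xs)) (moves xs))

deg : List ℕ → ℕ
deg xs = length (neighbours xs)

-- Let D be the r distinct part sizes of λ. For x ∈ D and y ∈ {0} ∪ D with
-- y ∉ {x, x − 1}, moving a cell from a part of size x to one of size y (a new
-- part if y = 0) gives a neighbour of λ. As multisets of parts it trades
-- {x, y} for {x − 1, y + 1}, which determines (x, y), so these at least
-- r(r − 1) neighbours are distinct. There is one more unless the parts are
-- distinct and x − 1 is a part for every part x > 1: if x − 1 ∉ {0} ∪ D then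
-- x has r targets, and if two parts are equal, moving a cell from one to the
-- other gives a neighbour outside the family. In the remaining case
-- λ = (r, r − 1, …, 1), whose size is T_r.
module Submission where

open import Data.Bool using (true; false)
open import Data.List using (List; []; _∷_; length; filter; deduplicate; map; cartesianProduct; _++_)
open import Data.List.Membership.Propositional using (_∈_; _∉_; find)
open import Data.List.Membership.Propositional.Properties
  using ( ∈-∃++; ∈-++⁻; ∈-++⁺ˡ; ∈-++⁺ʳ; ∈-concat⁺′; ∈-map⁺; ∈-map⁻; ∈-upTo⁺; ∈-filter⁺; ∈-filter⁻
        ; ∈-deduplicate⁺; ∈-deduplicate⁻; ∈-cartesianProduct⁻; ∈-length)
open import Data.List.Properties using (≡-dec; length-++; length-map; filter-++; filter-all)
open import Data.List.Relation.Binary.Subset.Propositional using (_⊆_)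
open import Data.List.Relation.Unary.All as All using (All; []; _∷_)
import Data.List.Relation.Unary.All.Properties as All
open import Data.List.Relation.Unary.All.Properties.Core using (¬All⇒Any¬)
open import Data.List.Relation.Unary.AllPairs as AllPairs using ([]; _∷_)
open import Data.List.Relation.Unary.Any as Any using (Any; here; there)
open import Data.List.Relation.Unary.Linked as Linked using (Linked; []; [-]; _∷_)
open import Data.List.Relation.Unary.Linked.Properties using (Linked⇒All; Linked⇒AllPairs)
open import Data.List.Relation.Unary.Unique.Propositional using (Unique)
import Data.List.Relation.Unary.Unique.Propositional.Properties as Unique
open import Data.Maybe using (just; nothing)
open import Data.Nat using (ℕ; zero; suc; _+_; _*_; _∸_; _≤_; _<_; _>_; _≥_; _/_; z≤n; s≤s; s≤s⁻¹; z<s; _≤ᵇ_)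
open import Data.Nat.DivMod using (m*n/n≡m; /-monoˡ-≤)
open import Data.Nat.ListAction using (sum)
open import Data.Nat.Properties
open import Data.Nat.Solver using (module +-*-Solver)
open import Data.Product using (_×_; _,_; ∃; uncurry)
open import Data.Sum using (_⊎_; inj₁; inj₂; [_,_]′)
open import Function using (_∘_; flip)
open import Level using (0ℓ)
open import Relation.Binary.Definitions using (DecidableEquality)
open import Relation.Binary.PropositionalEquality
open import Relation.Nullary using (¬_; yes; no; ¬?; _×-dec_; contradiction)
open import Relation.Nullary.Decidable using (decidable-stable)
open import Relation.Unary using (Pred; Decidable)
open import Relation.Unary.Properties using (∁?)

open import Defs

open import Algebra.Properties.CommutativeSemigroup +-commutativeSemigroup using (x∙yz≈y∙xz)
open import Data.List.Membership.DecPropositional _≟_ using (_∈?_)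
open import Data.List.Relation.Unary.Unique.DecPropositional.Properties _≟_ using (deduplicate-!)

open +-*-Solver using (solve; _:+_; _:*_; _:=_; con)

private
  variable
    A B : Set
    c i j x y x′ y′ : ℕ
    xs ys l E : List ℕ

Unique⇒length≤ : {xs ys : List A} → Unique xs → xs ⊆ ys → length xs ≤ length ys
Unique⇒length≤ {xs = []}     _               _     = z≤n
Unique⇒length≤ {xs = x ∷ xs} (x∉xs ∷ unique) xs⊆ys with ∈-∃++ (xs⊆ys (here refl))
... | us , vs , refl = begin
  suc (length xs)              ≤⟨ s≤s (Unique⇒length≤ unique xs⊆us++vs) ⟩
  suc (length (us ++ vs))      ≡⟨ cong suc (length-++ us) ⟩
  suc (length us + length vs)  ≡⟨ +-suc (length us) (length vs) ⟨
  length us + length (x ∷ vs)  ≡⟨ length-++ us ⟨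
  length (us ++ x ∷ vs)        ∎
  where
  open ≤-Reasoning
  xs⊆us++vs : xs ⊆ us ++ vs
  xs⊆us++vs z∈xs with ∈-++⁻ us (xs⊆ys (there z∈xs))
  ... | inj₁ z∈us         = ∈-++⁺ˡ z∈us
  ... | inj₂ (here refl)  = contradiction refl (All.lookup x∉xs z∈xs)
  ... | inj₂ (there z∈vs) = ∈-++⁺ʳ us z∈vs

Unique-map⁺ : {f : A → B} {xs : List A} →
  (∀ {a b} → a ∈ xs → b ∈ xs → f a ≡ f b → a ≡ b) → Unique xs → Unique (map f xs)
Unique-map⁺ _   []              = []
Unique-map⁺ inj (x∉xs ∷ unique) =
  All.map⁺ (All.tabulate λ a∈xs fx≡fa → All.lookup x∉xs a∈xs (inj (here refl) (there a∈xs) fx≡fa))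
  ∷ Unique-map⁺ (λ a∈xs b∈xs → inj (there a∈xs) (there b∈xs)) unique

deduplicate-Unique : (_≟ₐ_ : DecidableEquality A) {xs : List A} → Unique xs → deduplicate _≟ₐ_ xs ≡ xs
deduplicate-Unique _≟ₐ_ []                       = refl
deduplicate-Unique _≟ₐ_ {x ∷ xs} (x∉xs ∷ unique) = cong (x ∷_) (begin
  filter (λ y → ¬? (x ≟ₐ y)) (deduplicate _≟ₐ_ xs)  ≡⟨ cong (filter (λ y → ¬? (x ≟ₐ y))) (deduplicate-Unique _≟ₐ_ unique) ⟩
  filter (λ y → ¬? (x ≟ₐ y)) xs                     ≡⟨ filter-all (λ y → ¬? (x ≟ₐ y)) x∉xs ⟩
  xs                                                ∎)
  where open ≡-Reasoning

module _ {A : Set} {P : Pred A 0ℓ} (P? : Decidable P) where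

  length-filter+∁ : ∀ xs → length (filter P? xs) + length (filter (∁? P?) xs) ≡ length xs
  length-filter+∁ []       = refl
  length-filter+∁ (x ∷ xs) with P? x
  ... | yes _ = cong suc (length-filter+∁ xs)
  ... | no  _ = trans (+-suc _ _) (cong suc (length-filter+∁ xs))

  length≤rejected+filter : {xs zs : List A} → Unique xs → (∀ {y} → y ∈ xs → ¬ P y → y ∈ zs) →
    length xs ≤ length zs + length (filter P? xs)
  length≤rejected+filter {xs} {zs} unique rejected⊆zs = begin
    length xs                                           ≡⟨ length-filter+∁ xs ⟨
    length (filter P? xs) + length (filter (∁? P?) xs)  ≡⟨ +-comm (length (filter P? xs)) _ ⟩
    length (filter (∁? P?) xs) + length (filter P? xs)  ≤⟨ +-monoˡ-≤ _ (Unique⇒length≤ (Unique.filter⁺ (∁? P?) unique) rejected⊆) ⟩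
    length zs + length (filter P? xs)                   ∎
    where
    open ≤-Reasoning
    rejected⊆ : filter (∁? P?) xs ⊆ zs
    rejected⊆ y∈ = let y∈xs , ¬Py = ∈-filter⁻ (∁? P?) y∈ in rejected⊆zs y∈xs ¬Py

length-filter-map : {P : Pred B 0ℓ} (P? : Decidable P) (f : A → B) (xs : List A) →
  length (filter P? (map f xs)) ≡ length (filter (P? ∘ f) xs)
length-filter-map P? f []       = refl
length-filter-map P? f (x ∷ xs) with P? (f x)
... | yes _ = cong suc (length-filter-map P? f xs)
... | no  _ = length-filter-map P? f xs

length-filter-cartesianProduct : {P : Pred (A × B) 0ℓ} (P? : Decidable P) (xs : List A) (ys : List B) →
  length (filter P? (cartesianProduct xs ys)) ≡ sum (map (λ x → length (filter (P? ∘ (x ,_)) ys)) xs)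
length-filter-cartesianProduct P? []       ys = refl
length-filter-cartesianProduct P? (x ∷ xs) ys = begin
  length (filter P? (map (x ,_) ys ++ cartesianProduct xs ys))
    ≡⟨ cong length (filter-++ P? (map (x ,_) ys) (cartesianProduct xs ys)) ⟩
  length (filter P? (map (x ,_) ys) ++ filter P? (cartesianProduct xs ys))
    ≡⟨ length-++ (filter P? (map (x ,_) ys)) ⟩
  length (filter P? (map (x ,_) ys)) + length (filter P? (cartesianProduct xs ys))
    ≡⟨ cong₂ _+_ (length-filter-map P? (x ,_) ys) (length-filter-cartesianProduct P? xs ys) ⟩
  length (filter (P? ∘ (x ,_)) ys) + sum (map (λ x → length (filter (P? ∘ (x ,_)) ys)) xs) ∎
  where open ≡-Reasoning

module _ {A : Set} {f : A → ℕ} {k : ℕ} where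

  length*≤sum : {xs : List A} → All (λ x → k ≤ f x) xs → length xs * k ≤ sum (map f xs)
  length*≤sum []           = z≤n
  length*≤sum (k≤fx ∷ k≤f) = +-mono-≤ k≤fx (length*≤sum k≤f)

  length*<sum : {xs : List A} → All (λ x → k ≤ f x) xs → Any (λ x → k < f x) xs →
    length xs * k < sum (map f xs)
  length*<sum (_    ∷ k≤f) (here k<fx) = +-mono-<-≤ k<fx (length*≤sum k≤f)
  length*<sum (k≤fx ∷ k≤f) (there k<f) = +-mono-≤-< k≤fx (length*<sum k≤f k<f)

-- Multiplicities

δ : ℕ → ℕ → ℕ
δ c x with c ≟ x
... | yes _ = 1
... | no  _ = 0

δ-refl : ∀ c → δ c c ≡ 1
δ-refl c with c ≟ c
... | yes _   = refl
... | no  c≢c = contradiction refl c≢c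

δ-≢ : c ≢ x → δ c x ≡ 0
δ-≢ {c} {x} c≢x with c ≟ x
... | yes c≡x = contradiction c≡x c≢x
... | no  _   = refl

mult : ℕ → List ℕ → ℕ
mult c []       = 0
mult c (x ∷ xs) = δ c x + mult c xs

∈⇒mult>0 : c ∈ xs → mult c xs > 0
∈⇒mult>0 {c} (here refl) rewrite δ-refl c = s≤s z≤n
∈⇒mult>0 {c} {x ∷ _} (there c∈xs) = ≤-trans (∈⇒mult>0 c∈xs) (m≤n+m _ (δ c x))

mult>0⇒∈ : mult c xs > 0 → c ∈ xs
mult>0⇒∈ {c} {x ∷ xs} mult>0 with c ≟ x
... | yes c≡x = here c≡x
... | no  _   = there (mult>0⇒∈ mult>0)

mult-insertDesc : ∀ c x ys → mult c (insertDesc x ys) ≡ mult c (x ∷ ys)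
mult-insertDesc c x []       = refl
mult-insertDesc c x (y ∷ ys) with y ≤ᵇ x
... | true  = refl
... | false = trans (cong (δ c y +_) (mult-insertDesc c x ys)) (x∙yz≈y∙xz (δ c y) (δ c x) (mult c ys))

mult-sortDesc : ∀ c xs → mult c (sortDesc xs) ≡ mult c xs
mult-sortDesc c []       = refl
mult-sortDesc c (x ∷ xs) = trans (mult-insertDesc c x (sortDesc xs)) (cong (δ c x +_) (mult-sortDesc c xs))

mult-normalize : c ≢ 0 → ∀ xs → mult c (normalize xs) ≡ mult c xs
mult-normalize {c} c≢0 xs = trans (mult-sortDesc c (filter (λ x → ¬? (x ≟ 0)) xs)) (mult-filter xs)
  where
  mult-filter : ∀ xs → mult c (filter (λ x → ¬? (x ≟ 0)) xs) ≡ mult c xs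
  mult-filter []           = refl
  mult-filter (zero  ∷ xs) = trans (mult-filter xs) (cong (_+ mult c xs) (sym (δ-≢ c≢0)))
  mult-filter (suc x ∷ xs) = cong (δ c (suc x) +_) (mult-filter xs)

infix 4 _≈₊_

-- Equality as multisets of positive numbers: zeros are ignored, since a part
-- that shrinks to 0 disappears.
record _≈₊_ (xs ys : List ℕ) : Set where
  constructor same-mult
  field mult-≡ : ∀ c → c ≢ 0 → mult c xs ≡ mult c ys

open _≈₊_

≈₊-sym : xs ≈₊ ys → ys ≈₊ xs
≈₊-sym xs≈ys = same-mult λ c c≢0 → sym (mult-≡ xs≈ys c c≢0)

≈₊-∈ : xs ≈₊ ys → c ≢ 0 → c ∈ xs → c ∈ ys
≈₊-∈ {c = c} xs≈ys c≢0 c∈xs = mult>0⇒∈ (subst (_> 0) (mult-≡ xs≈ys c c≢0) (∈⇒mult>0 c∈xs))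

≈₊-drop-∷ : x ∷ xs ≈₊ x ∷ ys → xs ≈₊ ys
≈₊-drop-∷ {x} x∷xs≈x∷ys = same-mult λ c c≢0 → +-cancelˡ-≡ (δ c x) _ _ (mult-≡ x∷xs≈x∷ys c c≢0)

-- Moving one cell

-- E arises from l by moving a cell from a part of size x to one of size y,
-- with y = 0 standing for a new part.
MovesCell : ℕ → ℕ → List ℕ → List ℕ → Set
MovesCell x y l E = x ∷ y ∷ E ≈₊ x ∸ 1 ∷ suc y ∷ l

n≢0⇒n≢n∸1 : x ≢ 0 → x ≢ x ∸ 1
n≢0⇒n≢n∸1 {zero}  x≢0 = contradiction refl x≢0
n≢0⇒n≢n∸1 {suc x} _   = 1+n≢n

n∸1≢m⇒n≢1+m : x ∸ 1 ≢ y → x ≢ suc y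
n∸1≢m⇒n≢1+m x∸1≢y x≡1+y = x∸1≢y (cong (_∸ 1) x≡1+y)

-- Shaped to match mult c of the four-element lists in MovesCell-exchange.
cross-cancel : ∀ a b c d a′ b′ c′ d′ e m →
  a + (b + e) ≡ c + (d + m) → a′ + (b′ + e) ≡ c′ + (d′ + m) →
  a + (c′ + (b + (d′ + 0))) ≡ a′ + (c + (b′ + (d + 0)))
cross-cancel a b c d a′ b′ c′ d′ e m eq eq′ = +-cancelʳ-≡ (e + m) _ _ (begin
  a + (c′ + (b + (d′ + 0))) + (e + m)  ≡⟨ solve 6 (λ a b c′ d′ e m →
                                             a :+ (c′ :+ (b :+ (d′ :+ con 0))) :+ (e :+ m)
                                          := a :+ (b :+ e) :+ (c′ :+ (d′ :+ m))) refl a b c′ d′ e m ⟩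
  a + (b + e) + (c′ + (d′ + m))        ≡⟨ cong₂ _+_ eq (sym eq′) ⟩
  c + (d + m) + (a′ + (b′ + e))        ≡⟨ solve 6 (λ c d a′ b′ e m →
                                             c :+ (d :+ m) :+ (a′ :+ (b′ :+ e))
                                          := a′ :+ (c :+ (b′ :+ (d :+ con 0))) :+ (e :+ m)) refl c d a′ b′ e m ⟩
  a′ + (c + (b′ + (d + 0))) + (e + m)  ∎)
  where open ≡-Reasoning

MovesCell-exchange : MovesCell x y l E → MovesCell x′ y′ l E →
  x ∷ x′ ∸ 1 ∷ y ∷ suc y′ ∷ [] ≈₊ x′ ∷ x ∸ 1 ∷ y′ ∷ suc y ∷ []
MovesCell-exchange {x} {y} {l} {E} {x′} {y′} move move′ = same-mult λ c c≢0 →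
  cross-cancel (δ c x) (δ c y) (δ c (x ∸ 1)) (δ c (suc y))
               (δ c x′) (δ c y′) (δ c (x′ ∸ 1)) (δ c (suc y′)) (mult c E) (mult c l)
               (mult-≡ move c c≢0) (mult-≡ move′ c c≢0)

source-reappears : x ≢ 0 → x ∸ 1 ≢ y →
  x ∷ x′ ∸ 1 ∷ y ∷ suc y′ ∷ [] ≈₊ x′ ∷ x ∸ 1 ∷ y′ ∷ suc y ∷ [] → x ≡ x′ ⊎ x ≡ y′
source-reappears x≢0 x∸1≢y moves≈ with ≈₊-∈ moves≈ x≢0 (here refl)
... | here x≡x′                          = inj₁ x≡x′
... | there (here x≡x∸1)                 = contradiction x≡x∸1 (n≢0⇒n≢n∸1 x≢0)
... | there (there (here x≡y′))          = inj₂ x≡y′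
... | there (there (there (here x≡1+y))) = contradiction x≡1+y (n∸1≢m⇒n≢1+m x∸1≢y)
... | there (there (there (there ())))

swapped-moves-successive : x ≢ x′ →
  x ∷ x′ ∸ 1 ∷ x′ ∷ suc x ∷ [] ≈₊ x′ ∷ x ∸ 1 ∷ x ∷ suc x′ ∷ [] → suc x ≡ x′
swapped-moves-successive {x} x≢x′ moves≈ with ≈₊-∈ moves≈ (λ ()) (there (there (there (here refl))))
... | here 1+x≡x′                           = 1+x≡x′
... | there (here 1+x≡x∸1)                  = contradiction (sym 1+x≡x∸1) (<⇒≢ (s≤s (m∸n≤m x 1)))
... | there (there (here 1+x≡x))            = contradiction 1+x≡x 1+n≢n
... | there (there (there (here 1+x≡1+x′))) = contradiction (suc-injective 1+x≡1+x′) x≢x′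
... | there (there (there (there ())))

-- If x ≢ x′, then x = y′ and x′ = y, and the cells x + 1 and x′ + 1 force
-- x′ = x + 1 and x = x′ + 1.
exchange-injective : x ≢ 0 → x′ ≢ 0 → x ∸ 1 ≢ y → x′ ∸ 1 ≢ y′ →
  x ∷ x′ ∸ 1 ∷ y ∷ suc y′ ∷ [] ≈₊ x′ ∷ x ∸ 1 ∷ y′ ∷ suc y ∷ [] → x ≡ x′ × y ≡ y′
exchange-injective {x} {x′} x≢0 x′≢0 x∸1≢y x′∸1≢y′ moves≈ with x ≟ x′
... | yes refl = refl , same-target (≈₊-drop-∷ (≈₊-drop-∷ moves≈))
  where
  same-target : y ∷ suc y′ ∷ [] ≈₊ y′ ∷ suc y ∷ [] → y ≡ y′
  same-target targets≈ with ≈₊-∈ targets≈ (λ ()) (there (here refl))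
  ... | here 1+y′≡y′          = contradiction 1+y′≡y′ 1+n≢n
  ... | there (here 1+y′≡1+y) = sym (suc-injective 1+y′≡1+y)
  ... | there (there ())
... | no x≢x′
  with source-reappears x≢0 x∸1≢y moves≈ | source-reappears x′≢0 x′∸1≢y′ (≈₊-sym moves≈)
...   | inj₁ x≡x′ | _         = contradiction x≡x′ x≢x′
...   | inj₂ _    | inj₁ x′≡x = contradiction (sym x′≡x) x≢x′
...   | inj₂ refl | inj₂ refl =
  contradiction (trans (cong suc (swapped-moves-successive x≢x′ moves≈))
                       (swapped-moves-successive (≢-sym x≢x′) (≈₊-sym moves≈)))
                (≢-sym (m≢1+n+m x))

MovesCell-injective : x ≢ 0 → x′ ≢ 0 → x ∸ 1 ≢ y → x′ ∸ 1 ≢ y′ →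
  MovesCell x y l E → MovesCell x′ y′ l E → x ≡ x′ × y ≡ y′
MovesCell-injective x≢0 x′≢0 x∸1≢y x′∸1≢y′ move move′ =
  exchange-injective x≢0 x′≢0 x∸1≢y x′∸1≢y′ (MovesCell-exchange move move′)

MovesCell-≢ : x ≢ 0 → x ∸ 1 ≢ y → MovesCell x y l E → E ≢ l
MovesCell-≢ {x} {y} {l} x≢0 x∸1≢y move refl = m≢1+n+m (mult x l) (sym (begin
  suc (δ x y + mult x l)                  ≡⟨ cong (_+ (δ x y + mult x l)) (δ-refl x) ⟨
  δ x x + (δ x y + mult x l)              ≡⟨ mult-≡ move x x≢0 ⟩
  δ x (x ∸ 1) + (δ x (suc y) + mult x l)  ≡⟨ cong₂ (λ a b → a + (b + mult x l))
                                               (δ-≢ (n≢0⇒n≢n∸1 x≢0)) (δ-≢ (n∸1≢m⇒n≢1+m x∸1≢y)) ⟩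
  mult x l                                ∎))
  where open ≡-Reasoning

at : ℕ → List ℕ → ℕ
at _       []       = 0
at zero    (x ∷ _)  = x
at (suc i) (_ ∷ xs) = at i xs

at-∈ : i < length xs → at i xs ∈ xs
at-∈ {zero}  {_ ∷ _}  _         = here refl
at-∈ {suc i} {_ ∷ xs} (s≤s i<n) = there (at-∈ i<n)

indexOf : ℕ → List ℕ → ℕ
indexOf x []       = 0
indexOf x (y ∷ ys) with x ≟ y
... | yes _ = 0
... | no  _ = suc (indexOf x ys)

indexOf< : x ∈ xs → indexOf x xs < length xs
indexOf< {x} {y ∷ ys} x∈ with x ≟ y | x∈
... | yes _   | _          = s≤s z≤n
... | no  _   | there x∈ys = s≤s (indexOf< x∈ys)
... | no  x≢y | here x≡y   = contradiction x≡y x≢y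

at-indexOf : x ∈ xs → at (indexOf x xs) xs ≡ x
at-indexOf {x} {y ∷ ys} x∈ with x ≟ y | x∈
... | yes x≡y | _          = sym x≡y
... | no  _   | there x∈ys = at-indexOf x∈ys
... | no  x≢y | here x≡y   = contradiction x≡y x≢y

indexOf-≢ : x ∈ xs → y ∈ xs → x ≢ y → indexOf y xs ≢ indexOf x xs
indexOf-≢ {x} {xs} {y} x∈ y∈ x≢y eq =
  x≢y (trans (sym (at-indexOf x∈)) (trans (cong (λ k → at k xs) (sym eq)) (at-indexOf y∈)))

length-decAt : ∀ i xs → length (decAt i xs) ≡ length xs
length-decAt _       []       = refl
length-decAt zero    (_ ∷ _)  = refl
length-decAt (suc i) (_ ∷ xs) = cong suc (length-decAt i xs)

at-decAt : ∀ xs → j ≢ i → at j (decAt i xs) ≡ at j xs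
at-decAt []                       _   = refl
at-decAt {zero}  {zero}  (_ ∷ _)  j≢i = contradiction refl j≢i
at-decAt {zero}  {suc i} (_ ∷ _)  _   = refl
at-decAt {suc j} {zero}  (_ ∷ _)  _   = refl
at-decAt {suc j} {suc i} (_ ∷ xs) j≢i = at-decAt xs (j≢i ∘ cong suc)

mult-decAt : ∀ c xs → i < length xs → mult c (at i xs ∷ decAt i xs) ≡ mult c (at i xs ∸ 1 ∷ xs)
mult-decAt {zero}  c (x ∷ xs) _ = x∙yz≈y∙xz (δ c x) (δ c (x ∸ 1)) (mult c xs)
mult-decAt {suc i} c (x ∷ xs) (s≤s i<n) = begin
  δ c (at i xs) + (δ c x + mult c (decAt i xs))  ≡⟨ x∙yz≈y∙xz (δ c (at i xs)) (δ c x) _ ⟩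
  δ c x + (δ c (at i xs) + mult c (decAt i xs))  ≡⟨ cong (δ c x +_) (mult-decAt c xs i<n) ⟩
  δ c x + (δ c (at i xs ∸ 1) + mult c xs)        ≡⟨ x∙yz≈y∙xz (δ c x) (δ c (at i xs ∸ 1)) _ ⟩
  δ c (at i xs ∸ 1) + (δ c x + mult c xs)        ∎
  where open ≡-Reasoning

mult-incAt : ∀ c xs → i < length xs → mult c (at i xs ∷ incAt i xs) ≡ mult c (suc (at i xs) ∷ xs)
mult-incAt {zero}  c (x ∷ xs) _ = x∙yz≈y∙xz (δ c x) (δ c (suc x)) (mult c xs)
mult-incAt {suc i} c (x ∷ xs) (s≤s i<n) = begin
  δ c (at i xs) + (δ c x + mult c (incAt i xs))  ≡⟨ x∙yz≈y∙xz (δ c (at i xs)) (δ c x) _ ⟩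
  δ c x + (δ c (at i xs) + mult c (incAt i xs))  ≡⟨ cong (δ c x +_) (mult-incAt c xs i<n) ⟩
  δ c x + (δ c (suc (at i xs)) + mult c xs)      ≡⟨ x∙yz≈y∙xz (δ c x) (δ c (suc (at i xs))) _ ⟩
  δ c (suc (at i xs)) + (δ c x + mult c xs)      ∎
  where open ≡-Reasoning

move-just-MovesCell : ∀ l → i < length l → j < length l → j ≢ i →
  MovesCell (at i l) (at j l) l (move i (just j) l)
move-just-MovesCell {i} {j} l i<n j<n j≢i = same-mult λ c c≢0 → begin
  δ c xᵢ + (δ c xⱼ + mult c (normalize (incAt j (decAt i l))))
    ≡⟨ cong (λ n → δ c xᵢ + (δ c xⱼ + n)) (mult-normalize c≢0 (incAt j (decAt i l))) ⟩
  δ c xᵢ + (δ c xⱼ + mult c (incAt j (decAt i l)))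
    ≡⟨ cong (δ c xᵢ +_) (mult-incAt-decAt c) ⟩
  δ c xᵢ + (δ c (suc xⱼ) + mult c (decAt i l))
    ≡⟨ x∙yz≈y∙xz (δ c xᵢ) (δ c (suc xⱼ)) _ ⟩
  δ c (suc xⱼ) + (δ c xᵢ + mult c (decAt i l))
    ≡⟨ cong (δ c (suc xⱼ) +_) (mult-decAt c l i<n) ⟩
  δ c (suc xⱼ) + (δ c (xᵢ ∸ 1) + mult c l)
    ≡⟨ x∙yz≈y∙xz (δ c (suc xⱼ)) (δ c (xᵢ ∸ 1)) _ ⟩
  δ c (xᵢ ∸ 1) + (δ c (suc xⱼ) + mult c l) ∎
  where
  open ≡-Reasoning
  xᵢ xⱼ : ℕ
  xᵢ = at i l
  xⱼ = at j l
  mult-incAt-decAt : ∀ c → mult c (xⱼ ∷ incAt j (decAt i l)) ≡ mult c (suc xⱼ ∷ decAt i l)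
  mult-incAt-decAt c =
    subst (λ z → mult c (z ∷ incAt j (decAt i l)) ≡ mult c (suc z ∷ decAt i l)) (at-decAt l j≢i)
          (mult-incAt c (decAt i l) (subst (j <_) (sym (length-decAt i l)) j<n))

move-nothing-MovesCell : ∀ l → i < length l → MovesCell (at i l) 0 l (move i nothing l)
move-nothing-MovesCell {i} l i<n = same-mult λ c c≢0 → begin
  δ c xᵢ + (δ c 0 + mult c (normalize (1 ∷ decAt i l)))
    ≡⟨ cong₂ (λ a b → δ c xᵢ + (a + b)) (δ-≢ c≢0) (mult-normalize c≢0 (1 ∷ decAt i l)) ⟩
  δ c xᵢ + (δ c 1 + mult c (decAt i l))
    ≡⟨ x∙yz≈y∙xz (δ c xᵢ) (δ c 1) _ ⟩
  δ c 1 + (δ c xᵢ + mult c (decAt i l))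
    ≡⟨ cong (δ c 1 +_) (mult-decAt c l i<n) ⟩
  δ c 1 + (δ c (xᵢ ∸ 1) + mult c l)
    ≡⟨ x∙yz≈y∙xz (δ c 1) (δ c (xᵢ ∸ 1)) _ ⟩
  δ c (xᵢ ∸ 1) + (δ c 1 + mult c l) ∎
  where
  open ≡-Reasoning
  xᵢ : ℕ
  xᵢ = at i l

move-nothing-∈-moves : ∀ l → i < length l → move i nothing l ∈ moves l
move-nothing-∈-moves l i<n = ∈-concat⁺′ (here refl) (∈-map⁺ _ (∈-upTo⁺ i<n))

move-just-∈-moves : ∀ l → i < length l → j < length l → j ≢ i → move i (just j) l ∈ moves l
move-just-∈-moves {i} l i<n j<n j≢i =
  ∈-concat⁺′ (there (∈-map⁺ _ (∈-filter⁺ (λ k → ¬? (k ≟ i)) (∈-upTo⁺ j<n) j≢i)))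
             (∈-map⁺ _ (∈-upTo⁺ i<n))

∈-neighbours : E ∈ moves l → E ≢ l → E ∈ neighbours l
∈-neighbours {l = l} E∈moves E≢l =
  ∈-deduplicate⁺ (≡-dec _≟_) (∈-filter⁺ (λ m → ¬? (≡-dec _≟_ m l)) E∈moves E≢l)

moveCell : List ℕ → ℕ → ℕ → List ℕ
moveCell l x zero    = move (indexOf x l) nothing l
moveCell l x (suc y) = move (indexOf x l) (just (indexOf (suc y) l)) l

moveCell-∈-moves : x ∈ l → y ∈ 0 ∷ l → x ≢ y → moveCell l x y ∈ moves l
moveCell-∈-moves {l = l} {y = zero}  x∈l _             _     = move-nothing-∈-moves l (indexOf< x∈l)
moveCell-∈-moves {l = l} {y = suc _} x∈l (there 1+y∈l) x≢1+y =
  move-just-∈-moves l (indexOf< x∈l) (indexOf< 1+y∈l) (indexOf-≢ x∈l 1+y∈l x≢1+y)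

moveCell-MovesCell : x ∈ l → y ∈ 0 ∷ l → x ≢ y → MovesCell x y l (moveCell l x y)
moveCell-MovesCell {x} {l} {y = zero} x∈l _ _ =
  subst (λ a → MovesCell a 0 l (moveCell l x 0)) (at-indexOf x∈l) (move-nothing-MovesCell l (indexOf< x∈l))
moveCell-MovesCell {x} {l} {y = suc y} x∈l (there 1+y∈l) x≢1+y =
  subst₂ (λ a b → MovesCell a b l (moveCell l x (suc y))) (at-indexOf x∈l) (at-indexOf 1+y∈l)
    (move-just-MovesCell l (indexOf< x∈l) (indexOf< 1+y∈l) (indexOf-≢ x∈l 1+y∈l x≢1+y))

-- Candidate neighbours

distinctParts : List ℕ → List ℕ
distinctParts = deduplicate _≟_

-- Moving a cell from x to x ∸ 1 gives back the partition, and moving it from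
-- x to x may be impossible; every other pair of sizes yields its own neighbour.
Admissible : ℕ × ℕ → Set
Admissible (x , y) = x ≢ y × x ∸ 1 ≢ y

admissible? : Decidable Admissible
admissible? (x , y) = ¬? (x ≟ y) ×-dec ¬? (x ∸ 1 ≟ y)

¬Admissible⇒ : ¬ Admissible (x , y) → y ≡ x ⊎ y ≡ x ∸ 1
¬Admissible⇒ {x} {y} inadmissible with x ≟ y
... | yes x≡y = inj₁ (sym x≡y)
... | no  x≢y = inj₂ (sym (decidable-stable (x ∸ 1 ≟ y) (inadmissible ∘ (x≢y ,_))))

candidates : List ℕ → List (ℕ × ℕ)
candidates l = filter admissible? (cartesianProduct (distinctParts l) (0 ∷ distinctParts l))

candidateNeighbours : List ℕ → List (List ℕ)
candidateNeighbours l = map (uncurry (moveCell l)) (candidates l)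

targets : List ℕ → ℕ → List ℕ
targets l x = filter (admissible? ∘ (x ,_)) (0 ∷ distinctParts l)

∈-candidates⁻ : (x , y) ∈ candidates l → x ∈ l × y ∈ 0 ∷ l × Admissible (x , y)
∈-candidates⁻ {l = l} xy∈ with ∈-filter⁻ admissible? xy∈
... | xy∈product , admissible with ∈-cartesianProduct⁻ (distinctParts l) (0 ∷ distinctParts l) xy∈product
...   | x∈parts , here y≡0      = ∈-deduplicate⁻ _≟_ l x∈parts , here y≡0 , admissible
...   | x∈parts , there y∈parts =
  ∈-deduplicate⁻ _≟_ l x∈parts , there (∈-deduplicate⁻ _≟_ l y∈parts) , admissible

positive⇒≢0 : All (0 <_) l → x ∈ l → x ≢ 0
positive⇒≢0 positive x∈l = >⇒≢ (All.lookup positive x∈l)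

candidate-MovesCell : (x , y) ∈ candidates l → MovesCell x y l (moveCell l x y)
candidate-MovesCell xy∈ = let x∈l , y∈0∷l , x≢y , _ = ∈-candidates⁻ xy∈ in moveCell-MovesCell x∈l y∈0∷l x≢y

Unique-0∷distinctParts : All (0 <_) l → Unique (0 ∷ distinctParts l)
Unique-0∷distinctParts {l} positive = 0∉parts ∷ deduplicate-! l
  where
  0∉parts : All (0 ≢_) (distinctParts l)
  0∉parts = All.tabulate λ z∈parts 0≡z → positive⇒≢0 positive (∈-deduplicate⁻ _≟_ l z∈parts) (sym 0≡z)

candidateNeighbours-Unique : All (0 <_) l → Unique (candidateNeighbours l)
candidateNeighbours-Unique {l} positive = Unique-map⁺ injective
  (Unique.filter⁺ admissible? (Unique.cartesianProduct⁺ (deduplicate-! l) (Unique-0∷distinctParts positive)))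
  where
  injective : ∀ {p q} → p ∈ candidates l → q ∈ candidates l →
    uncurry (moveCell l) p ≡ uncurry (moveCell l) q → p ≡ q
  injective {x , y} {x′ , y′} p∈ q∈ same
    with x∈l , _ , _ , x∸1≢y ← ∈-candidates⁻ p∈ | x′∈l , _ , _ , x′∸1≢y′ ← ∈-candidates⁻ q∈
    with refl , refl ← MovesCell-injective (positive⇒≢0 positive x∈l) (positive⇒≢0 positive x′∈l)
                         x∸1≢y x′∸1≢y′ (candidate-MovesCell p∈)
                         (subst (MovesCell x′ y′ l) (sym same) (candidate-MovesCell q∈))
    = refl

candidateNeighbours-⊆ : All (0 <_) l → candidateNeighbours l ⊆ neighbours l
candidateNeighbours-⊆ {l} positive E∈ with (x , y) , xy∈ , refl ← ∈-map⁻ (uncurry (moveCell l)) E∈ =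
  let x∈l , y∈0∷l , x≢y , x∸1≢y = ∈-candidates⁻ xy∈ in
  ∈-neighbours (moveCell-∈-moves x∈l y∈0∷l x≢y)
               (MovesCell-≢ (positive⇒≢0 positive x∈l) x∸1≢y (candidate-MovesCell xy∈))

length-candidates : ∀ l → length (candidates l) ≡ sum (map (length ∘ targets l) (distinctParts l))
length-candidates l = length-filter-cartesianProduct admissible? (distinctParts l) (0 ∷ distinctParts l)

length-targets≥ : All (0 <_) l → ∀ x → σ l ∸ 1 ≤ length (targets l x)
length-targets≥ {l} positive x = m≤n+o⇒m∸n≤o (suc (σ l)) 2
  (length≤rejected+filter (admissible? ∘ (x ,_)) {zs = x ∷ x ∸ 1 ∷ []} (Unique-0∷distinctParts positive)
    (λ _ → [ here , there ∘ here ]′ ∘ ¬Admissible⇒))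

length-targets≥-gap : All (0 <_) l → x ∸ 1 ∉ 0 ∷ l → σ l ≤ length (targets l x)
length-targets≥-gap {l} {x} positive x∸1∉ = s≤s⁻¹
  (length≤rejected+filter (admissible? ∘ (x ,_)) (Unique-0∷distinctParts positive) rejected)
  where
  rejected : ∀ {y} → y ∈ 0 ∷ distinctParts l → ¬ Admissible (x , y) → y ∈ x ∷ []
  rejected y∈ inadmissible with ¬Admissible⇒ inadmissible | y∈
  ... | inj₁ y≡x  | _                     = here y≡x
  ... | inj₂ refl | here x∸1≡0            = contradiction (here x∸1≡0) x∸1∉
  ... | inj₂ refl | there x∸1∈parts       = contradiction (there (∈-deduplicate⁻ _≟_ l x∸1∈parts)) x∸1∉

length-candidates≥ : All (0 <_) l → σ l * (σ l ∸ 1) ≤ length (candidates l)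
length-candidates≥ {l} positive = begin
  σ l * (σ l ∸ 1)                                  ≤⟨ length*≤sum {xs = distinctParts l} (All.tabulate λ {x} _ → length-targets≥ positive x) ⟩
  sum (map (length ∘ targets l) (distinctParts l))  ≡⟨ length-candidates l ⟨
  length (candidates l)                            ∎
  where open ≤-Reasoning

length-candidates>-gap : All (0 <_) l → x ∈ l → x ∸ 1 ∉ 0 ∷ l → σ l * (σ l ∸ 1) < length (candidates l)
length-candidates>-gap {l} {x} positive x∈l x∸1∉ = begin-strict
  σ l * (σ l ∸ 1)                                  <⟨ length*<sum {xs = distinctParts l} (All.tabulate λ {x} _ → length-targets≥ positive x)
                                                                   (Any.map (λ { refl → more-targets }) x∈parts) ⟩
  sum (map (length ∘ targets l) (distinctParts l))  ≡⟨ length-candidates l ⟨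
  length (candidates l)                            ∎
  where
  open ≤-Reasoning
  x∈parts : x ∈ distinctParts l
  x∈parts = ∈-deduplicate⁺ _≟_ x∈l
  more-targets : σ l ∸ 1 < length (targets l x)
  more-targets = <-≤-trans (∸-monoʳ-< z<s (∈-length x∈parts)) (length-targets≥-gap {x = x} positive x∸1∉)

length-candidates≤deg : All (0 <_) l → length (candidates l) ≤ deg l
length-candidates≤deg {l} positive = begin
  length (candidates l)           ≡⟨ length-map (uncurry (moveCell l)) (candidates l) ⟨
  length (candidateNeighbours l)  ≤⟨ Unique⇒length≤ (candidateNeighbours-Unique positive) (candidateNeighbours-⊆ positive) ⟩
  deg l                           ∎
  where open ≤-Reasoning

-- Moving a cell between two equal parts x gives a neighbour outside the
-- candidates, since (x , x) is not admissible.
length-candidates<deg-repeated : All (0 <_) l → suc i < length l → at i l ≡ at (suc i) l →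
  length (candidates l) < deg l
length-candidates<deg-repeated {l} {i} positive 1+i<n repeated = begin
  suc (length (candidates l))           ≡⟨ cong suc (length-map (uncurry (moveCell l)) (candidates l)) ⟨
  length (E₀ ∷ candidateNeighbours l)   ≤⟨ Unique⇒length≤ (E₀∉candidates ∷ candidateNeighbours-Unique positive) E₀∷⊆ ⟩
  deg l                                 ∎
  where
  open ≤-Reasoning
  i<n : i < length l
  i<n = <-trans (n<1+n i) 1+i<n
  x₀ : ℕ
  x₀ = at i l
  x₀≢0 : x₀ ≢ 0
  x₀≢0 = positive⇒≢0 positive (at-∈ i<n)
  x₀∸1≢x₀ : x₀ ∸ 1 ≢ x₀
  x₀∸1≢x₀ = ≢-sym (n≢0⇒n≢n∸1 x₀≢0)
  E₀ : List ℕ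
  E₀ = move i (just (suc i)) l
  E₀-moves : MovesCell x₀ x₀ l E₀
  E₀-moves = subst (λ y → MovesCell x₀ y l E₀) (sym repeated) (move-just-MovesCell l i<n 1+i<n 1+n≢n)
  E₀∉candidates : All (E₀ ≢_) (candidateNeighbours l)
  E₀∉candidates = All.tabulate λ E∈ E₀≡E →
    let (x , y) , xy∈ , E≡ = ∈-map⁻ (uncurry (moveCell l)) E∈
        x∈l , _ , x≢y , x∸1≢y = ∈-candidates⁻ xy∈
        x₀≡x , x₀≡y = MovesCell-injective x₀≢0 (positive⇒≢0 positive x∈l) x₀∸1≢x₀ x∸1≢y
                        E₀-moves (subst (MovesCell x y l) (sym (trans E₀≡E E≡)) (candidate-MovesCell xy∈))
    in x≢y (trans (sym x₀≡x) x₀≡y)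
  E₀∷⊆ : E₀ ∷ candidateNeighbours l ⊆ neighbours l
  E₀∷⊆ (here refl) = ∈-neighbours (move-just-∈-moves l i<n 1+i<n 1+n≢n) (MovesCell-≢ x₀≢0 x₀∸1≢x₀ E₀-moves)
  E₀∷⊆ (there E∈)  = candidateNeighbours-⊆ positive E∈

-- Staircases

repeated-or-strict : Linked _≥_ l → (∃ λ i → suc i < length l × at i l ≡ at (suc i) l) ⊎ Linked _>_ l
repeated-or-strict []  = inj₂ []
repeated-or-strict [-] = inj₂ [-]
repeated-or-strict {x ∷ y ∷ l} (x≥y ∷ sorted) with x ≟ y | repeated-or-strict sorted
... | yes x≡y | _                           = inj₁ (0 , s≤s (s≤s z≤n) , x≡y)
... | no  _   | inj₁ (i , 1+i<n , repeated) = inj₁ (suc i , s≤s 1+i<n , repeated)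
... | no  x≢y | inj₂ decreasing             = inj₂ (≤∧≢⇒< x≥y (≢-sym x≢y) ∷ decreasing)

DownClosed : List ℕ → Set
DownClosed l = All (λ x → x ∸ 1 ∈ 0 ∷ l) l

Linked>-head : Linked _>_ (x ∷ l) → All (_< x) l
Linked>-head {l = []}    _                  = []
Linked>-head {l = _ ∷ _} (x>y ∷ decreasing) = Linked⇒All (flip <-trans) x>y decreasing

DownClosed-tail : Linked _>_ (x ∷ l) → DownClosed (x ∷ l) → DownClosed l
DownClosed-tail decreasing (_ ∷ closed) =
  All.zipWith (λ (y<x , y∸1∈) → drop-larger (≤-<-trans (m∸n≤m _ 1) y<x) y∸1∈) (Linked>-head decreasing , closed)
  where
  drop-larger : y < x → y ∈ 0 ∷ x ∷ l → y ∈ 0 ∷ l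
  drop-larger _   (here y≡0)          = here y≡0
  drop-larger y<x (there (here y≡x))  = contradiction y≡x (<⇒≢ y<x)
  drop-larger _   (there (there y∈l)) = there y∈l

DownClosed⇒≤length : Linked _>_ l → DownClosed l → All (_≤ length l) l
DownClosed⇒≤length {[]}    _          _      = []
DownClosed⇒≤length {x ∷ l} decreasing closed = head≤ x (All.head closed) ∷ All.map m≤n⇒m≤1+n tail≤
  where
  tail≤ : All (_≤ length l) l
  tail≤ = DownClosed⇒≤length (Linked.tail decreasing) (DownClosed-tail decreasing closed)
  head≤ : ∀ x → x ∸ 1 ∈ 0 ∷ x ∷ l → x ≤ suc (length l)
  head≤ zero    _                    = z≤n
  head≤ (suc x) (here refl)          = s≤s z≤n
  head≤ (suc x) (there (here x≡1+x)) = contradiction (sym x≡1+x) 1+n≢n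
  head≤ (suc x) (there (there x∈l))  = s≤s (All.lookup tail≤ x∈l)

staircase-sum : Linked _>_ l → DownClosed l → 2 * sum l ≤ length l * (length l + 1)
staircase-sum {[]}    _          _      = z≤n
staircase-sum {x ∷ l} decreasing closed = begin
  2 * (x + sum l)          ≡⟨ *-distribˡ-+ 2 x (sum l) ⟩
  2 * x + 2 * sum l        ≤⟨ +-mono-≤ (*-monoʳ-≤ 2 (All.head (DownClosed⇒≤length decreasing closed)))
                                        (staircase-sum (Linked.tail decreasing) (DownClosed-tail decreasing closed)) ⟩
  2 * suc n + n * (n + 1)  ≡⟨ solve 1 (λ n → con 2 :* (con 1 :+ n) :+ n :* (n :+ con 1)
                                          := (con 1 :+ n) :* (con 1 :+ n :+ con 1)) refl n ⟩
  suc n * (suc n + 1)      ∎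
  where
  open ≤-Reasoning
  n : ℕ
  n = length l

staircase-size : Linked _>_ l → DownClosed l → size l ≤ σ l * (σ l + 1) / 2
staircase-size {l} decreasing closed = begin
  sum l                          ≡⟨ m*n/n≡m (sum l) 2 ⟨
  sum l * 2 / 2                  ≤⟨ /-monoˡ-≤ 2 (≤-trans (≤-reflexive (*-comm (sum l) 2)) (staircase-sum decreasing closed)) ⟩
  length l * (length l + 1) / 2  ≡⟨ cong (λ n → n * (n + 1) / 2) σ≡length ⟨
  σ l * (σ l + 1) / 2            ∎
  where
  open ≤-Reasoning
  σ≡length : σ l ≡ length l
  σ≡length = cong length (deduplicate-Unique _≟_ (AllPairs.map >⇒≢ (Linked⇒AllPairs (flip <-trans) decreasing)))

corollary4p5 : (l : List ℕ) (r : ℕ) → IsPartition l → σ l ≡ r →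
    r * (r + 1) / 2 < size l → r * (r ∸ 1) + 1 ≤ deg l
corollary4p5 l _ (sorted , positive) refl size> = ≤-trans (≤-reflexive (+-comm _ 1)) deg>
  where
  deg> : σ l * (σ l ∸ 1) < deg l
  deg> with All.all? (λ x → x ∸ 1 ∈? 0 ∷ l) l
  ... | no ¬closed =
    let x , x∈l , x∸1∉ = find (¬All⇒Any¬ (λ x → x ∸ 1 ∈? 0 ∷ l) l ¬closed)
    in <-≤-trans (length-candidates>-gap positive x∈l x∸1∉) (length-candidates≤deg positive)
  ... | yes closed with repeated-or-strict sorted
  ...   | inj₁ (i , 1+i<n , repeated) =
    ≤-<-trans (length-candidates≥ positive) (length-candidates<deg-repeated positive 1+i<n repeated)
  ...   | inj₂ decreasing = contradiction (staircase-size decreasing closed) (<⇒≱ size>)
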